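{- Let $K$ be a $2$-collapsible simplicial complex on a finite set $V$ and let $M$ be a matroid on $V$ with rank function $\rho$. If $M\subset\mathcal{T}_1(K)$, then there exists $\sigma\in\mathcal{T}_1(K)$ such that $\rho(V\setminus\sigma)\le 5$.
   Context: A simplicial complex on $V$ is a family of subsets of $V$ closed under subsets. A face is free if it lies in exactly one maximal face; an elementary $2$-collapse removes all faces containing a free face of size at most $2$; $K$ is $2$-collapsible if it can be reduced to the void complex by a sequence of elementary $2$-collapses. $\mathcal{T}_1(K)=\{\eta\cup\tau:\ \eta\in K,\ \tau\subset V,\ |\tau|\le 1\}$. A matroid on $V$ is a family $M$ of subsets of $V$ with $\varnothing\in M$, closed under subsets, and such that if $A,B\in M$ with $|A|<|B|$ then $A\cup\{x\}\in M$ for some $x\in B\setminus A$; its rank function is $\rho(W)=\max\{|W'|:W'\subset W,\ W'\in M\}$. -}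

module Defs where

open import Data.Nat using (ℕ; _≤_; _<_)
open import Data.Bool using (Bool; true; false; _∧_; not)
open import Data.Fin.Subset using (Subset; _⊆_; _∪_; ∣_∣; ⊥; ∁)
open import Data.Fin.Subset.Properties using (_⊆?_)
open import Data.Product using (Σ; ∃; _×_; _,_)
open import Relation.Binary.PropositionalEquality using (_≡_)
open import Relation.Nullary.Decidable using (⌊_⌋)

-- A family of subsets of V = Fin n, given by its (decidable) characteristic function.
Family : ℕ → Set
Family n = Subset n → Bool

_∈F_ : ∀ {n} → Subset n → Family n → Set
σ ∈F F = F σ ≡ true

IsComplex : ∀ {n} → Family n → Set
IsComplex K = ∀ σ τ → τ ⊆ σ → σ ∈F K → τ ∈F K

-- the void complex (no faces at all, not even ∅)
IsVoid : ∀ {n} → Family n → Set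
IsVoid K = ∀ σ → K σ ≡ false

IsMaximalFace : ∀ {n} → Family n → Subset n → Set
IsMaximalFace K σ = σ ∈F K × (∀ τ → τ ∈F K → σ ⊆ τ → τ ≡ σ)

IsFree : ∀ {n} → Family n → Subset n → Set
IsFree K σ = σ ∈F K × Σ (Subset _) λ τ →
  (IsMaximalFace K τ × σ ⊆ τ) ×
  (∀ τ' → IsMaximalFace K τ' → σ ⊆ τ' → τ' ≡ τ)

removeStar : ∀ {n} → Family n → Subset n → Family n
removeStar K σ ρ = K ρ ∧ not ⌊ σ ⊆? ρ ⌋

data TwoCollapsible {n : ℕ} (K : Family n) : Set where
  void     : IsVoid K → TwoCollapsible K
  collapse : (σ : Subset n) → IsFree K σ → ∣ σ ∣ ≤ 2 →
             TwoCollapsible (removeStar K σ) → TwoCollapsible K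

InT₁ : ∀ {n} → Family n → Subset n → Set
InT₁ K σ = Σ (Subset _) λ η → Σ (Subset _) λ τ → η ∈F K × ∣ τ ∣ ≤ 1 × σ ≡ η ∪ τ

IsMatroid : ∀ {n} → Family n → Set
IsMatroid M =
  (⊥ ∈F M) ×
  (∀ A B → B ⊆ A → A ∈F M → B ∈F M) ×
  (∀ A B → A ∈F M → B ∈F M → ∣ A ∣ < ∣ B ∣ →
     Σ _ λ x → (x Data.Fin.Subset.∈ B) × (x Data.Fin.Subset.∉ A) × ((A ∪ Data.Fin.Subset.⁅ x ⁆) ∈F M))

-- ρ(W) ≤ k, where ρ(W) = max { |W'| : W' ⊆ W, W' ∈ M }  (literal unfolding of max ≤ k)
RankAtMost : ∀ {n} → Family n → Subset n → ℕ → Set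
RankAtMost M W k = ∀ W' → W' ⊆ W → W' ∈F M → ∣ W' ∣ ≤ k

{-# OPTIONS --safe #-}
module Submission where

-- Let σ (∣σ∣ ≤ 2) be the free face removed first, τ its
-- unique maximal face and K′ the remaining complex.  If σ = ∅, every face lies in τ and
-- ρ(V ∖ τ) ≤ 1.  Otherwise either every independent set lies in T₁(K′) and we recurse, or
-- some independent A = η ∪ t with σ ⊆ η ⊆ τ has no A - y (y ∈ σ) in K.  Then A has exactly one
-- element x outside τ, and every nonface inside A contains x.  Minimal nonfaces of a
-- 2-collapsible complex have at most 3 vertices, so one or two small nonfaces avoiding the
-- points of σ, together with σ, form an independent S ⊆ A with ∣S∣ ≤ 5 that no element outside
-- τ ∪ ⁅x⁆ extends; by augmentation ρ(V ∖ (τ ∪ ⁅x⁆)) ≤ 5.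

open import Defs
open import Data.Nat using (ℕ; zero; suc; _+_; _≤_; _<_; z≤n; s≤s)
open import Data.Nat.Properties
  using ( ≤-trans; <-≤-trans; ≤-<-trans; ≰⇒>; +-mono-≤; +-monoʳ-<; +-suc; n≤1+n; _≤?_
        ; ≤-refl; ≤-reflexive; ≤-pred; module ≤-Reasoning)
open import Data.Bool using (true; false)
open import Data.Bool.Properties using (not-¬) renaming (_≟_ to _≟ᴮ_)
open import Data.Fin using (Fin; _≟_)
import Data.Fin as Fin
open import Data.Fin.Properties using (any?)
open import Data.Fin.Subset
  using (Subset; ∁; ⊥; ⁅_⁆; _∪_; _-_; ∣_∣; _∈_; _∉_; _⊆_; _⊃_; Empty; inside; outside)
open import Data.Fin.Subset.Properties
open import Data.Fin.Subset.Induction using (⊃-wellFounded)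
open import Induction.WellFounded using (Acc; acc)
open import Data.Vec.Base using (_∷_; []; there)
open import Data.Product using (Σ; ∃; _×_; _,_; proj₁; proj₂)
open import Data.Sum using (_⊎_; inj₁; inj₂; [_,_]′; map₁)
open import Data.Empty using (⊥-elim)
open import Function using (_∘_; id; const)
open import Relation.Nullary using (¬_; Dec; yes; no; contradiction)
open import Relation.Nullary.Decidable using (_×-dec_; ¬?; decidable-stable)
open import Relation.Binary.PropositionalEquality using (_≡_; _≢_; refl; sym; subst)

∣p∪q∣≤∣p∣+∣q∣ : ∀ {n} (p q : Subset n) → ∣ p ∪ q ∣ ≤ ∣ p ∣ + ∣ q ∣
∣p∪q∣≤∣p∣+∣q∣ [] [] = z≤n
∣p∪q∣≤∣p∣+∣q∣ (outside ∷ p) (outside ∷ q) = ∣p∪q∣≤∣p∣+∣q∣ p q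
∣p∪q∣≤∣p∣+∣q∣ (outside ∷ p) (inside ∷ q) =
  ≤-trans (s≤s (∣p∪q∣≤∣p∣+∣q∣ p q)) (≤-reflexive (sym (+-suc ∣ p ∣ ∣ q ∣)))
∣p∪q∣≤∣p∣+∣q∣ (inside ∷ p) (outside ∷ q) = s≤s (∣p∪q∣≤∣p∣+∣q∣ p q)
∣p∪q∣≤∣p∣+∣q∣ (inside ∷ p) (inside ∷ q) =
  s≤s (≤-trans (∣p∪q∣≤∣p∣+∣q∣ p q) (+-mono-≤ (≤-refl {∣ p ∣}) (n≤1+n ∣ q ∣)))

∪-least : ∀ {n} (p q : Subset n) {r} → p ⊆ r → q ⊆ r → p ∪ q ⊆ r
∪-least p q p⊆r q⊆r x∈p∪q = [ p⊆r , q⊆r ]′ (x∈p∪q⁻ p q x∈p∪q)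

x∈p∪q∧x∉p⇒x∈q : ∀ {n} (p q : Subset n) {x} → x ∈ p ∪ q → x ∉ p → x ∈ q
x∈p∪q∧x∉p⇒x∈q p q x∈p∪q x∉p = [ ⊥-elim ∘ x∉p , id ]′ (x∈p∪q⁻ p q x∈p∪q)

x∈p⇒⁅x⁆⊆p : ∀ {n} {p : Subset n} {x} → x ∈ p → ⁅ x ⁆ ⊆ p
x∈p⇒⁅x⁆⊆p {x = x} x∈p y∈⁅x⁆ = subst (_∈ _) (sym (x∈⁅y⁆⇒x≡y x y∈⁅x⁆)) x∈p

x∉p-x : ∀ {n} (p : Subset n) x → x ∉ p - x
x∉p-x (_ ∷ p) Fin.zero ()
x∉p-x (_ ∷ p) (Fin.suc x) (there x∈p-x) = x∉p-x p x x∈p-x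

x∈p⇒0<∣p∣ : ∀ {n} {p : Subset n} {x} → x ∈ p → 0 < ∣ p ∣
x∈p⇒0<∣p∣ x∈p = ≤-trans (s≤s z≤n) (x∈p⇒∣p-x∣<∣p∣ x∈p)

∣p∣≤1+k∧x∈p⇒∣p-x∣≤k : ∀ {n k} {p : Subset n} {x} → ∣ p ∣ ≤ suc k → x ∈ p → ∣ p - x ∣ ≤ k
∣p∣≤1+k∧x∈p⇒∣p-x∣≤k ∣p∣≤1+k x∈p = ≤-pred (<-≤-trans (x∈p⇒∣p-x∣<∣p∣ x∈p) ∣p∣≤1+k)

∣p∣≤1⇒x≡y : ∀ {n} {p : Subset n} {x y} → ∣ p ∣ ≤ 1 → x ∈ p → y ∈ p → y ≡ x
∣p∣≤1⇒x≡y {x = x} {y} ∣p∣≤1 x∈p y∈p with y ≟ x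
... | yes y≡x = y≡x
... | no y≢x = contradiction
  (≤-trans (x∈p⇒0<∣p∣ (x∈p∧x≢y⇒x∈p-y y∈p y≢x)) (∣p∣≤1+k∧x∈p⇒∣p-x∣≤k ∣p∣≤1 x∈p)) λ ()

∣p∣≤2⇒z≡x⊎z≡y : ∀ {n} {p : Subset n} {x y z} → ∣ p ∣ ≤ 2 → x ∈ p → y ∈ p → y ≢ x → z ∈ p →
  z ≡ x ⊎ z ≡ y
∣p∣≤2⇒z≡x⊎z≡y {x = x} {z = z} ∣p∣≤2 x∈p y∈p y≢x z∈p with z ≟ x
... | yes z≡x = inj₁ z≡x
... | no z≢x = inj₂ (∣p∣≤1⇒x≡y (∣p∣≤1+k∧x∈p⇒∣p-x∣≤k ∣p∣≤2 x∈p)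
                      (x∈p∧x≢y⇒x∈p-y y∈p y≢x) (x∈p∧x≢y⇒x∈p-y z∈p z≢x))

x∈p∩q⇒∣p∪q∣<∣p∣+∣q∣ : ∀ {n} (p q : Subset n) {x} → x ∈ p → x ∈ q → ∣ p ∪ q ∣ < ∣ p ∣ + ∣ q ∣
x∈p∩q⇒∣p∪q∣<∣p∣+∣q∣ p q {x} x∈p x∈q = begin-strict
  ∣ p ∪ q ∣           ≤⟨ p⊆q⇒∣p∣≤∣q∣ (∪-least p q (p⊆p∪q (q - x)) q⊆p∪q-x) ⟩
  ∣ p ∪ (q - x) ∣     ≤⟨ ∣p∪q∣≤∣p∣+∣q∣ p (q - x) ⟩
  ∣ p ∣ + ∣ q - x ∣   <⟨ +-monoʳ-< ∣ p ∣ (x∈p⇒∣p-x∣<∣p∣ x∈q) ⟩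
  ∣ p ∣ + ∣ q ∣       ∎
  where
  open ≤-Reasoning
  q⊆p∪q-x : q ⊆ p ∪ (q - x)
  q⊆p∪q-x {v} v∈q with v ≟ x
  ... | yes refl = p⊆p∪q (q - x) x∈p
  ... | no v≢x = q⊆p∪q p (q - x) (x∈p∧x≢y⇒x∈p-y v∈q v≢x)

p≡p-x∪⁅x⁆ : ∀ {n} {p : Subset n} {x} → x ∈ p → p ≡ (p - x) ∪ ⁅ x ⁆
p≡p-x∪⁅x⁆ {p = p} {x} x∈p = ⊆-antisym p⊆ (∪-least (p - x) ⁅ x ⁆ (p─q⊆p p ⁅ x ⁆) (x∈p⇒⁅x⁆⊆p x∈p))
  where
  p⊆ : p ⊆ (p - x) ∪ ⁅ x ⁆
  p⊆ {v} v∈p with v ≟ x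
  ... | yes refl = q⊆p∪q (p - x) ⁅ x ⁆ (x∈⁅x⁆ x)
  ... | no v≢x = p⊆p∪q ⁅ x ⁆ (x∈p∧x≢y⇒x∈p-y v∈p v≢x)

p⊈q⇒∃x∈p∖q : ∀ {n} {p q : Subset n} → ¬ (p ⊆ q) → ∃ λ x → x ∈ p × x ∉ q
p⊈q⇒∃x∈p∖q {p = p} {q} p⊈q with any? (λ x → (x ∈? p) ×-dec ¬? (x ∈? q))
... | yes witness = witness
... | no none = ⊥-elim (p⊈q λ {x} x∈p → decidable-stable (x ∈? q) (λ x∉q → none (x , x∈p , x∉q)))

uniqueOutside : ∀ {n} {A η t τ : Subset n} → A ≡ η ∪ t → ∣ t ∣ ≤ 1 → η ⊆ τ → ¬ (A ⊆ τ) →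
  ∃ λ x → x ∈ A × x ∉ τ × (∀ {v} → v ∈ A → v ∉ τ → v ≡ x)
uniqueOutside {A = A} {η} {t} {τ} A≡η∪t ∣t∣≤1 η⊆τ A⊈τ with p⊈q⇒∃x∈p∖q A⊈τ
... | x , x∈A , x∉τ = x , x∈A , x∉τ , λ v∈A v∉τ → ∣p∣≤1⇒x≡y ∣t∣≤1 (∈t x∈A x∉τ) (∈t v∈A v∉τ)
  where
  ∈t : ∀ {v} → v ∈ A → v ∉ τ → v ∈ t
  ∈t v∈A v∉τ = x∈p∪q∧x∉p⇒x∈q η t (subst (_ ∈_) A≡η∪t v∈A) (v∉τ ∘ η⊆τ)

∀Subset-⊎⇒⊎ : ∀ {n} {P : Subset n → Set} {Q : Set} → (∀ A → P A ⊎ Q) → (∀ A → P A) ⊎ Q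
∀Subset-⊎⇒⊎ {zero} f with f []
... | inj₁ p = inj₁ λ { [] → p }
... | inj₂ q = inj₂ q
∀Subset-⊎⇒⊎ {suc n} f with ∀Subset-⊎⇒⊎ (f ∘ (inside ∷_)) | ∀Subset-⊎⇒⊎ (f ∘ (outside ∷_))
... | inj₂ q | _ = inj₂ q
... | inj₁ _ | inj₂ q = inj₂ q
... | inj₁ pᵢ | inj₁ pₒ = inj₁ λ { (inside ∷ A) → pᵢ A ; (outside ∷ A) → pₒ A }

_∈F?_ : ∀ {n} (σ : Subset n) (F : Family n) → Dec (σ ∈F F)
σ ∈F? F = F σ ≟ᴮ true

maximalFace⊇ : ∀ {n} (K : Family n) {F} → F ∈F K → Σ (Subset n) λ G → F ⊆ G × IsMaximalFace K G
maximalFace⊇ {n} K {F} F∈K = go F (⊃-wellFounded F) F∈K ⊆-refl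
  where
  go : ∀ G → Acc _⊃_ G → G ∈F K → F ⊆ G → Σ (Subset n) λ G → F ⊆ G × IsMaximalFace K G
  go G (acc rs) G∈K F⊆G with anySubset? (λ H → (H ∈F? K) ×-dec (G ⊂? H))
  ... | yes (H , H∈K , G⊂H) = go H (rs G⊂H) H∈K (⊆-trans F⊆G (proj₁ G⊂H))
  ... | no noLarger = G , F⊆G , G∈K , maximal
    where
    maximal : ∀ H → H ∈F K → G ⊆ H → H ≡ G
    maximal H H∈K G⊆H with H ⊆? G
    ... | yes H⊆G = ⊆-antisym H⊆G G⊆H
    ... | no H⊈G = ⊥-elim (noLarger (H , H∈K , G⊆H , p⊈q⇒∃x∈p∖q H⊈G))

module FreeFace {n} {K : Family n} {σ} (fr : IsFree K σ) where

  τ : Subset n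
  τ = proj₁ (proj₂ fr)

  τ∈K : τ ∈F K
  τ∈K = proj₁ (proj₁ (proj₁ (proj₂ (proj₂ fr))))

  coface⊆τ : ∀ {F} → F ∈F K → σ ⊆ F → F ⊆ τ
  coface⊆τ {F} F∈K σ⊆F with maximalFace⊇ K F∈K
  ... | G , F⊆G , G-max = subst (F ⊆_) (proj₂ (proj₂ (proj₂ fr)) G G-max (⊆-trans σ⊆F F⊆G)) F⊆G

removeStar⁻ : ∀ {n} (K : Family n) σ {ρ} → ρ ∈F removeStar K σ → ρ ∈F K × ¬ (σ ⊆ ρ)
removeStar⁻ K σ {ρ} ρ∈K′ with K ρ | σ ⊆? ρ
removeStar⁻ K σ {ρ} () | false | _
removeStar⁻ K σ {ρ} () | true | yes _
removeStar⁻ K σ {ρ} refl | true | no σ⊈ρ = refl , σ⊈ρ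

removeStar⁺ : ∀ {n} (K : Family n) σ {ρ} → ρ ∈F K → ¬ (σ ⊆ ρ) → ρ ∈F removeStar K σ
removeStar⁺ K σ {ρ} ρ∈K σ⊈ρ with K ρ | σ ⊆? ρ
removeStar⁺ K σ {ρ} refl σ⊈ρ | true | yes σ⊆ρ = ⊥-elim (σ⊈ρ σ⊆ρ)
removeStar⁺ K σ {ρ} refl σ⊈ρ | true | no _ = refl

removed⇒σ⊆ : ∀ {n} (K : Family n) σ {ρ} → ρ ∈F K → ¬ (ρ ∈F removeStar K σ) → σ ⊆ ρ
removed⇒σ⊆ K σ {ρ} ρ∈K ρ∉K′ = decidable-stable (σ ⊆? ρ) (ρ∉K′ ∘ removeStar⁺ K σ ρ∈K)

removeStar-isComplex : ∀ {n} {K : Family n} σ → IsComplex K → IsComplex (removeStar K σ)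
removeStar-isComplex {K = K} σ K-cx ρ ρ′ ρ′⊆ρ ρ∈K′ with removeStar⁻ K σ ρ∈K′
... | ρ∈K , σ⊈ρ = removeStar⁺ K σ (K-cx ρ ρ′ ρ′⊆ρ ρ∈K) (λ σ⊆ρ′ → σ⊈ρ (⊆-trans σ⊆ρ′ ρ′⊆ρ))

smallNonface⊆ : ∀ {n} {K : Family n} → IsComplex K → TwoCollapsible K → ∀ {B} → ¬ (B ∈F K) →
  Σ (Subset n) λ N → N ⊆ B × ∣ N ∣ ≤ 3 × ¬ (N ∈F K)
smallNonface⊆ {n} _ (void K-void) _ = ⊥ , ⊥⊆ , ≤-trans (≤-reflexive (∣⊥∣≡0 n)) z≤n , not-¬ (K-void ⊥)
smallNonface⊆ {n} {K} K-cx (collapse σ fr ∣σ∣≤2 tc) {B} B∉K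
  with smallNonface⊆ (removeStar-isComplex σ K-cx) tc (B∉K ∘ proj₁ ∘ removeStar⁻ K σ)
... | N , N⊆B , ∣N∣≤3 , N∉K′ with N ∈F? K
...   | no N∉K = N , N⊆B , ∣N∣≤3 , N∉K
...   | yes N∈K = σ ∪ ⁅ z ⁆ , ∪-least σ ⁅ z ⁆ (N⊆B ∘ σ⊆N) (x∈p⇒⁅x⁆⊆p z∈B) , ∣σ∪z∣≤3 , σ∪z∉K
  where
  open FreeFace fr
  σ⊆N : σ ⊆ N
  σ⊆N = removed⇒σ⊆ K σ N∈K N∉K′
  z∈B∖τ : ∃ λ z → z ∈ B × z ∉ τ
  z∈B∖τ = p⊈q⇒∃x∈p∖q (λ B⊆τ → B∉K (K-cx τ B B⊆τ τ∈K))
  z : Fin n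
  z = proj₁ z∈B∖τ
  z∈B : z ∈ B
  z∈B = proj₁ (proj₂ z∈B∖τ)
  ∣σ∪z∣≤3 : ∣ σ ∪ ⁅ z ⁆ ∣ ≤ 3
  ∣σ∪z∣≤3 = ≤-trans (∣p∪q∣≤∣p∣+∣q∣ σ ⁅ z ⁆) (+-mono-≤ ∣σ∣≤2 (≤-reflexive (∣⁅x⁆∣≡1 z)))
  σ∪z∉K : ¬ ((σ ∪ ⁅ z ⁆) ∈F K)
  σ∪z∉K σ∪z∈K = proj₂ (proj₂ z∈B∖τ) (coface⊆τ σ∪z∈K (p⊆p∪q ⁅ z ⁆) (q⊆p∪q σ ⁅ z ⁆ (x∈⁅x⁆ z)))

InT₁-mono : ∀ {n} {K K′ : Family n} → (∀ {ρ} → ρ ∈F K′ → ρ ∈F K) → ∀ {A} → InT₁ K′ A → InT₁ K A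
InT₁-mono K′⊆K (η , t , η∈K′ , ∣t∣≤1 , A≡η∪t) = η , t , K′⊆K η∈K′ , ∣t∣≤1 , A≡η∪t

unextendable⇒RankAtMost : ∀ {n} {M : Family n} → IsMatroid M → ∀ {S T k} → S ∈F M → ∣ S ∣ ≤ k →
  (∀ z → z ∉ T → z ∉ S → ¬ ((S ∪ ⁅ z ⁆) ∈F M)) → RankAtMost M (∁ T) k
unextendable⇒RankAtMost (_ , _ , augment) {S} {k = k} S∈M ∣S∣≤k unextendable W W⊆∁T W∈M
  with ∣ W ∣ ≤? k
... | yes ∣W∣≤k = ∣W∣≤k
... | no ∣W∣≰k with augment S W S∈M W∈M (≤-<-trans ∣S∣≤k (≰⇒> ∣W∣≰k))
...   | z , z∈W , z∉S , S∪z∈M = ⊥-elim (unextendable z (x∈∁p⇒x∉p (W⊆∁T z∈W)) z∉S S∪z∈M)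

RankAtMost-mono : ∀ {n} {M : Family n} {W j k} → j ≤ k → RankAtMost M W j → RankAtMost M W k
RankAtMost-mono j≤k rank≤j W′ W′⊆W W′∈M = ≤-trans (rank≤j W′ W′⊆W W′∈M) j≤k

RankCovered : ∀ {n} → Family n → Family n → ℕ → Set
RankCovered {n} K M k = Σ (Subset n) λ σ → InT₁ K σ × RankAtMost M (∁ σ) k

Separates : ∀ {n} → Family n → Subset n → Subset n → Set
Separates {n} K σ S = ∀ y → y ∈ σ → Σ (Subset n) λ N → N ⊆ S × y ∉ N × ¬ (N ∈F K)

module _ {n} {K M : Family n} (K-cx : IsComplex K) (M-mat : IsMatroid M)
  (M⊆T₁K : ∀ A → A ∈F M → InT₁ K A) {σ} (fr : IsFree K σ) where
  open FreeFace fr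

  empty-free⇒RankAtMost∁τ : Empty σ → RankAtMost M (∁ τ) 1
  empty-free⇒RankAtMost∁τ σ-empty W W⊆∁τ W∈M with M⊆T₁K W W∈M
  ... | η , t , η∈K , ∣t∣≤1 , W≡η∪t = ≤-trans (p⊆q⇒∣p∣≤∣q∣ W⊆t) ∣t∣≤1
    where
    η⊆τ : η ⊆ τ
    η⊆τ = coface⊆τ η∈K (λ y∈σ → ⊥-elim (σ-empty (_ , y∈σ)))
    W⊆t : W ⊆ t
    W⊆t v∈W = x∈p∪q∧x∉p⇒x∈q η t (subst (_ ∈_) W≡η∪t v∈W) (x∈∁p⇒x∉p (W⊆∁τ v∈W) ∘ η⊆τ)

  -- Write S ∪ ⁅ z ⁆ = η ∪ t with η ∈ K.  If σ ⊆ η then η ⊆ τ, so x and z both lie in t;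
  -- otherwise some y ∈ σ lies in t, and the nonface separating y from the rest of S lies in η.
  separating⇒RankAtMost∁τ∪x : ∀ {S x k} → x ∉ τ → x ∈ S → σ ⊆ S → Separates K σ S →
    S ∈F M → ∣ S ∣ ≤ k → RankAtMost M (∁ (τ ∪ ⁅ x ⁆)) k
  separating⇒RankAtMost∁τ∪x {S} {x} x∉τ x∈S σ⊆S separates S∈M ∣S∣≤k =
    unextendable⇒RankAtMost M-mat S∈M ∣S∣≤k unextendable
    where
    unextendable : ∀ z → z ∉ τ ∪ ⁅ x ⁆ → z ∉ S → ¬ ((S ∪ ⁅ z ⁆) ∈F M)
    unextendable z z∉τ∪x z∉S S∪z∈M with M⊆T₁K _ S∪z∈M
    ... | η , t , η∈K , ∣t∣≤1 , S∪z≡η∪t with σ ⊆? η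
    ...   | yes σ⊆η = z∉τ∪x (subst (_∈ τ ∪ ⁅ x ⁆) (sym z≡x) (q⊆p∪q τ ⁅ x ⁆ (x∈⁅x⁆ x)))
      where
      ∈t : ∀ {v} → v ∈ S ∪ ⁅ z ⁆ → v ∉ τ → v ∈ t
      ∈t v∈S∪z v∉τ = x∈p∪q∧x∉p⇒x∈q η t (subst (_ ∈_) S∪z≡η∪t v∈S∪z) (v∉τ ∘ coface⊆τ η∈K σ⊆η)
      z≡x : z ≡ x
      z≡x = ∣p∣≤1⇒x≡y ∣t∣≤1 (∈t (p⊆p∪q ⁅ z ⁆ x∈S) x∉τ)
                           (∈t (q⊆p∪q S ⁅ z ⁆ (x∈⁅x⁆ z)) (z∉τ∪x ∘ p⊆p∪q ⁅ x ⁆))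
    ...   | no σ⊈η with p⊈q⇒∃x∈p∖q σ⊈η
    ...     | y , y∈σ , y∉η with separates y y∈σ
    ...       | N , N⊆S , y∉N , N∉K = N∉K (K-cx η N N⊆η η∈K)
      where
      ∈η∪t : ∀ {v} → v ∈ S → v ∈ η ∪ t
      ∈η∪t v∈S = subst (_ ∈_) S∪z≡η∪t (p⊆p∪q ⁅ z ⁆ v∈S)
      y∈t : y ∈ t
      y∈t = x∈p∪q∧x∉p⇒x∈q η t (∈η∪t (σ⊆S y∈σ)) y∉η
      N⊆η : N ⊆ η
      N⊆η v∈N = [ id , (λ v∈t → ⊥-elim (y∉N (subst (_∈ N) (∣p∣≤1⇒x≡y ∣t∣≤1 y∈t v∈t) v∈N))) ]′
                (x∈p∪q⁻ η t (∈η∪t (N⊆S v∈N)))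

module _ {n} {K : Family n} (K-cx : IsComplex K) (K-2c : TwoCollapsible K)
  {σ} (fr : IsFree K σ) (∣σ∣≤2 : ∣ σ ∣ ≤ 2) {A x} (x∈A : x ∈ A) (σ⊆A : σ ⊆ A)
  (A∖τ⊆⁅x⁆ : ∀ {v} → v ∈ A → v ∉ FreeFace.τ fr → v ≡ x)
  (A-y∉K : ∀ {y} → y ∈ σ → ¬ ((A - y) ∈F K)) where
  open FreeFace fr

  record SeparatingSet (S : Subset n) : Set where
    field
      S⊆A : S ⊆ A
      x∈S : x ∈ S
      σ⊆S : σ ⊆ S
      separates : Separates K σ S
      ∣S∣≤5 : ∣ S ∣ ≤ 5

  nonface⊆A⇒x∈ : ∀ {N} → N ⊆ A → ¬ (N ∈F K) → x ∈ N
  nonface⊆A⇒x∈ {N} N⊆A N∉K = decidable-stable (x ∈? N) (λ x∉N → N∉K (K-cx τ N (N⊆τ x∉N) τ∈K))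
    where
    N⊆τ : x ∉ N → N ⊆ τ
    N⊆τ x∉N {v} v∈N = decidable-stable (v ∈? τ)
      (λ v∉τ → x∉N (subst (_∈ N) (A∖τ⊆⁅x⁆ (N⊆A v∈N) v∉τ) v∈N))

  smallNonface⊆A-avoiding : ∀ {y} → y ∈ σ → Σ (Subset n) λ N → N ⊆ A × y ∉ N × ∣ N ∣ ≤ 3 × ¬ (N ∈F K)
  smallNonface⊆A-avoiding {y} y∈σ with smallNonface⊆ K-cx K-2c (A-y∉K y∈σ)
  ... | N , N⊆A-y , ∣N∣≤3 , N∉K = N , p─q⊆p A ⁅ y ⁆ ∘ N⊆A-y , x∉p-x A y ∘ N⊆A-y , ∣N∣≤3 , N∉K

  σ∪nonface-separating : ∀ {N} → N ⊆ A → ∣ N ∣ ≤ 3 → ¬ (N ∈F K) → (∀ {y} → y ∈ σ → y ∉ N) →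
    SeparatingSet (σ ∪ N)
  σ∪nonface-separating {N} N⊆A ∣N∣≤3 N∉K σ∩N≡∅ = record
    { S⊆A = ∪-least σ N σ⊆A N⊆A
    ; x∈S = q⊆p∪q σ N (nonface⊆A⇒x∈ N⊆A N∉K)
    ; σ⊆S = p⊆p∪q N
    ; separates = λ y y∈σ → N , q⊆p∪q σ N , σ∩N≡∅ y∈σ , N∉K
    ; ∣S∣≤5 = ≤-trans (∣p∪q∣≤∣p∣+∣q∣ σ N) (+-mono-≤ ∣σ∣≤2 ∣N∣≤3)
    }

  -- Both nonfaces contain x, so their union has at most 3 + 3 - 1 elements.
  crossedNonfaces-separating : ∀ {a b Nₐ N_b} → a ∈ σ → b ∈ σ →
    Nₐ ⊆ A → ∣ Nₐ ∣ ≤ 3 → ¬ (Nₐ ∈F K) → a ∉ Nₐ → b ∈ Nₐ →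
    N_b ⊆ A → ∣ N_b ∣ ≤ 3 → ¬ (N_b ∈F K) → b ∉ N_b → a ∈ N_b →
    SeparatingSet (Nₐ ∪ N_b)
  crossedNonfaces-separating {a} {b} {Nₐ} {N_b} a∈σ b∈σ
    Nₐ⊆A ∣Nₐ∣≤3 Nₐ∉K a∉Nₐ b∈Nₐ N_b⊆A ∣N_b∣≤3 N_b∉K b∉N_b a∈N_b = record
    { S⊆A = ∪-least Nₐ N_b Nₐ⊆A N_b⊆A
    ; x∈S = p⊆p∪q N_b x∈Nₐ
    ; σ⊆S = σ⊆Nₐ∪N_b
    ; separates = separates
    ; ∣S∣≤5 = ≤-pred (<-≤-trans (x∈p∩q⇒∣p∪q∣<∣p∣+∣q∣ Nₐ N_b x∈Nₐ (nonface⊆A⇒x∈ N_b⊆A N_b∉K))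
                                (+-mono-≤ ∣Nₐ∣≤3 ∣N_b∣≤3))
    }
    where
    x∈Nₐ : x ∈ Nₐ
    x∈Nₐ = nonface⊆A⇒x∈ Nₐ⊆A Nₐ∉K
    a-or-b : ∀ {y} → y ∈ σ → y ≡ a ⊎ y ≡ b
    a-or-b = ∣p∣≤2⇒z≡x⊎z≡y ∣σ∣≤2 a∈σ b∈σ (λ { refl → a∉Nₐ b∈Nₐ })
    σ⊆Nₐ∪N_b : σ ⊆ Nₐ ∪ N_b
    σ⊆Nₐ∪N_b y∈σ with a-or-b y∈σ
    ... | inj₁ refl = q⊆p∪q Nₐ N_b a∈N_b
    ... | inj₂ refl = p⊆p∪q N_b b∈Nₐ
    separates : Separates K σ (Nₐ ∪ N_b)
    separates y y∈σ with a-or-b y∈σ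
    ... | inj₁ refl = Nₐ , p⊆p∪q N_b , a∉Nₐ , Nₐ∉K
    ... | inj₂ refl = N_b , q⊆p∪q Nₐ N_b , b∉N_b , N_b∉K

  separatingSet : ∀ {a} → a ∈ σ → ∃ SeparatingSet
  separatingSet {a} a∈σ with smallNonface⊆A-avoiding a∈σ
  ... | Nₐ , Nₐ⊆A , a∉Nₐ , ∣Nₐ∣≤3 , Nₐ∉K with any? (λ b → (b ∈? σ) ×-dec (b ∈? Nₐ))
  ...   | no σ∩Nₐ≡∅ =
    σ ∪ Nₐ , σ∪nonface-separating Nₐ⊆A ∣Nₐ∣≤3 Nₐ∉K (λ y∈σ y∈Nₐ → σ∩Nₐ≡∅ (_ , y∈σ , y∈Nₐ))
  ...   | yes (b , b∈σ , b∈Nₐ) with smallNonface⊆A-avoiding b∈σ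
  ...     | N_b , N_b⊆A , b∉N_b , ∣N_b∣≤3 , N_b∉K with a ∈? N_b
  ...       | yes a∈N_b = Nₐ ∪ N_b , crossedNonfaces-separating a∈σ b∈σ
                            Nₐ⊆A ∣Nₐ∣≤3 Nₐ∉K a∉Nₐ b∈Nₐ N_b⊆A ∣N_b∣≤3 N_b∉K b∉N_b a∈N_b
  ...       | no a∉N_b = σ ∪ N_b , σ∪nonface-separating N_b⊆A ∣N_b∣≤3 N_b∉K σ∩N_b≡∅
    where
    σ∩N_b≡∅ : ∀ {y} → y ∈ σ → y ∉ N_b
    σ∩N_b≡∅ y∈σ with ∣p∣≤2⇒z≡x⊎z≡y ∣σ∣≤2 a∈σ b∈σ (λ { refl → a∉Nₐ b∈Nₐ }) y∈σ
    ... | inj₁ refl = a∉N_b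
    ... | inj₂ refl = b∉N_b

module _ {n} {K M : Family n} (K-cx : IsComplex K) (K-2c : TwoCollapsible K) (M-mat : IsMatroid M)
  (M⊆T₁K : ∀ A → A ∈F M → InT₁ K A) {σ} (fr : IsFree K σ) (∣σ∣≤2 : ∣ σ ∣ ≤ 2) {a} (a∈σ : a ∈ σ) where
  open FreeFace fr

  unliftable⇒RankCovered : ∀ {A η t} → A ∈F M → A ≡ η ∪ t → ∣ t ∣ ≤ 1 → η ⊆ τ → σ ⊆ A →
    (∀ {y} → y ∈ σ → ¬ ((A - y) ∈F K)) → RankCovered K M 5
  unliftable⇒RankCovered {A} A∈M A≡η∪t ∣t∣≤1 η⊆τ σ⊆A A-y∉K
    with uniqueOutside A≡η∪t ∣t∣≤1 η⊆τ (λ A⊆τ → A-y∉K a∈σ (K-cx τ (A - a) (A⊆τ ∘ p─q⊆p A ⁅ a ⁆) τ∈K))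
  ... | x , x∈A , x∉τ , A∖τ⊆⁅x⁆ with separatingSet K-cx K-2c fr ∣σ∣≤2 x∈A σ⊆A A∖τ⊆⁅x⁆ A-y∉K a∈σ
  ...   | S , S-separating =
    τ ∪ ⁅ x ⁆ , (τ , ⁅ x ⁆ , τ∈K , ≤-reflexive (∣⁅x⁆∣≡1 x) , refl) ,
    separating⇒RankAtMost∁τ∪x K-cx M-mat M⊆T₁K fr x∉τ x∈S σ⊆S separates
      (proj₁ (proj₂ M-mat) A S S⊆A A∈M) ∣S∣≤5
    where open SeparatingSet S-separating

  liftOrCover-σ⊆ : ∀ {A η t} → A ∈F M → A ≡ η ∪ t → ∣ t ∣ ≤ 1 → η ⊆ τ → σ ⊆ A →
    InT₁ (removeStar K σ) A ⊎ RankCovered K M 5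
  liftOrCover-σ⊆ {A} A∈M A≡η∪t ∣t∣≤1 η⊆τ σ⊆A with any? (λ y → (y ∈? σ) ×-dec ((A - y) ∈F? K))
  ... | yes (y , y∈σ , A-y∈K) = inj₁
    (A - y , ⁅ y ⁆ , removeStar⁺ K σ A-y∈K (λ σ⊆A-y → x∉p-x A y (σ⊆A-y y∈σ)) ,
     ≤-reflexive (∣⁅x⁆∣≡1 y) , p≡p-x∪⁅x⁆ (σ⊆A y∈σ))
  ... | no none = inj₂
    (unliftable⇒RankCovered A∈M A≡η∪t ∣t∣≤1 η⊆τ σ⊆A (λ y∈σ A-y∈K → none (_ , y∈σ , A-y∈K)))

  liftOrCover : ∀ A → (A ∈F M → InT₁ (removeStar K σ) A) ⊎ RankCovered K M 5
  liftOrCover A with A ∈F? M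
  ... | no A∉M = inj₁ (⊥-elim ∘ A∉M)
  ... | yes A∈M with M⊆T₁K A A∈M
  ...   | η , t , η∈K , ∣t∣≤1 , A≡η∪t with η ∈F? removeStar K σ
  ...     | yes η∈K′ = inj₁ λ _ → η , t , η∈K′ , ∣t∣≤1 , A≡η∪t
  ...     | no η∉K′ = map₁ const (liftOrCover-σ⊆ A∈M A≡η∪t ∣t∣≤1 (coface⊆τ η∈K σ⊆η) σ⊆A)
    where
    σ⊆η : σ ⊆ η
    σ⊆η = removed⇒σ⊆ K σ η∈K η∉K′
    σ⊆A : σ ⊆ A
    σ⊆A y∈σ = subst (_ ∈_) (sym A≡η∪t) (p⊆p∪q t (σ⊆η y∈σ))

rankCovered : ∀ {n} {K M : Family n} → IsComplex K → TwoCollapsible K → IsMatroid M →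
  (∀ A → A ∈F M → InT₁ K A) → RankCovered K M 5
rankCovered K-cx (void K-void) M-mat M⊆T₁K with M⊆T₁K ⊥ (proj₁ M-mat)
... | η , _ , η∈K , _ = ⊥-elim (not-¬ (K-void η) η∈K)
rankCovered {n} {K} K-cx K-2c@(collapse σ fr ∣σ∣≤2 K′-2c) M-mat M⊆T₁K with nonempty? σ
... | no σ-empty =
  τ , (τ , ⊥ , τ∈K , ≤-trans (≤-reflexive (∣⊥∣≡0 n)) z≤n , sym (∪-identityʳ τ)) ,
  RankAtMost-mono (s≤s z≤n) (empty-free⇒RankAtMost∁τ K-cx M-mat M⊆T₁K fr σ-empty)
  where open FreeFace fr
... | yes (a , a∈σ) with ∀Subset-⊎⇒⊎ (liftOrCover K-cx K-2c M-mat M⊆T₁K fr ∣σ∣≤2 a∈σ)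
...   | inj₂ covered = covered
...   | inj₁ M⊆T₁K′ with rankCovered (removeStar-isComplex σ K-cx) K′-2c M-mat M⊆T₁K′
...     | ρ , ρ∈T₁K′ , rank≤5 = ρ , InT₁-mono (proj₁ ∘ removeStar⁻ K σ) ρ∈T₁K′ , rank≤5

theorem6p5 : (n : ℕ) (K M : Family n) →
    IsComplex K → TwoCollapsible K → IsMatroid M →
    (∀ A → A ∈F M → InT₁ K A) →
    Σ (Subset n) λ σ → InT₁ K σ × RankAtMost M (∁ σ) 5
theorem6p5 n K M K-cx K-2c M-mat M⊆T₁K = rankCovered K-cx K-2c M-mat M⊆T₁K
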